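{- Let $m\ge1$, $u_i>0$, $v_i>0$, $d_i:=u_i+v_i$ for $i=1,\dots,m$, $D:=\max_i d_i$, and $0<\delta<\frac12$ with $d_i\in[0,\delta D]\cup[(1-\delta)D,D]$ for every $i$. Consider three greedy patterns $p_{z^a},p_{z^b},p_{z^c}$, all living on sub-strips of $[0,D]$. If the sorting of the three patterns by their end points $p(m)$ is not a cyclic permutation of the sorting of the patterns by their start points $p(0)$, then at least two of the three patterns are $\frac12\delta D$-close.
   Context: A solution is $z=(z_1,\dots,z_m)$ with $z_i\in\{v_i,-u_i\}$; its pattern is $p_z(k)=p_z(0)+\sum_{i=1}^k z_i$ for $k=0,\dots,m$ (start point $p_z(0)$, end point $p_z(m)$); it lives on a sub-strip of $[0,D]$ if $p_z(k)\in[0,D]$ for all $k$. A forward greedy pattern has start point $p_z(0)\in[\frac14\delta D,(1-\frac14\delta)D]$ and, for $k=1,\dots,m$ in turn, $z_k\in\{v_k,-u_k\}$ is chosen such that $p_z(k)=p_z(k-1)+z_k\in[0,D]$ and, among such choices, $p_z(k)$ is as close as possible to $\frac12D$ (remaining ties broken arbitrarily). A backward greedy pattern has end point $p_z(m)\in[\frac14\delta D,(1-\frac14\delta)D]$ and, for $k=m,m-1,\dots,1$ in turn, $z_k\in\{v_k,-u_k\}$ is chosen and $p_z(k-1):=p_z(k)-z_k$ set so that $|p_z(k-1)-\frac12D|$ is minimal (ties broken arbitrarily). A greedy pattern is a forward or a backward greedy pattern. Two patterns $p,p'$ are $\varepsilon$-close if $|p(j)-p'(j)|\le\varepsilon$ for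 some $j\in\{0,\dots,m\}$.
   Formalization: The numbers $u_i$, $v_i$, $D$, $\delta$ and all points of the three greedy patterns are rational. -}

module Defs where

open import Data.Nat using (ℕ; zero; suc)
open import Data.Fin using (Fin; zero; suc; inject₁)
open import Data.Integer using (+_)
open import Data.Rational using (ℚ; _+_; _-_; -_; _*_; _/_; _≤_; _<_; ∣_∣; 0ℚ; 1ℚ; ½)
open import Data.Product using (_×_; Σ; ∃)
open import Data.Sum using (_⊎_)
open import Relation.Binary.PropositionalEquality using (_≡_; _≢_)

¼ : ℚ
¼ = + 1 / 4

-- Pattern of a solution with start point p0 and steps z (z i is z_{i+1} in the paper):
-- pattern p0 z k = p0 + z_1 + ... + z_k,  k = 0,...,m.
pattern′ : ∀ {m} → ℚ → (Fin m → ℚ) → Fin (suc m) → ℚ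
pattern′ p0 z zero = p0
pattern′ {suc m} p0 z (suc k) = pattern′ (p0 + z zero) (λ i → z (suc i)) k

IsSolution : ∀ {m} → (u v : Fin m → ℚ) → (Fin m → ℚ) → Set
IsSolution u v z = ∀ i → (z i ≡ v i) ⊎ (z i ≡ - u i)

InInterval : ℚ → ℚ → ℚ → Set
InInterval lo hi x = (lo ≤ x) × (x ≤ hi)

LivesOnStrip : ∀ {m} → ℚ → ℚ → (Fin m → ℚ) → Set
LivesOnStrip D p0 z = ∀ k → InInterval 0ℚ D (pattern′ p0 z k)

ForwardGreedy : ∀ {m} → (u v : Fin m → ℚ) → (D δ : ℚ) → ℚ → (Fin m → ℚ) → Set
ForwardGreedy u v D δ p0 z =
  IsSolution u v z ×
  InInterval (¼ * δ * D) ((1ℚ - ¼ * δ) * D) p0 ×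
  (∀ i → InInterval 0ℚ D (pattern′ p0 z (suc i)) ×
         (∀ w → (w ≡ v i) ⊎ (w ≡ - u i) →
            InInterval 0ℚ D (pattern′ p0 z (inject₁ i) + w) →
            ∣ pattern′ p0 z (suc i) - ½ * D ∣ ≤ ∣ pattern′ p0 z (inject₁ i) + w - ½ * D ∣))

-- backward greedy pattern (p(k-1) = p(k) - z_k, chosen with |p(k-1) - D/2| minimal)
BackwardGreedy : ∀ {m} → (u v : Fin m → ℚ) → (D δ : ℚ) → ℚ → (Fin m → ℚ) → Set
BackwardGreedy {m} u v D δ p0 z =
  IsSolution u v z ×
  InInterval (¼ * δ * D) ((1ℚ - ¼ * δ) * D) (pattern′ p0 z (Data.Fin.fromℕ m)) ×
  (∀ i → ∀ w → (w ≡ v i) ⊎ (w ≡ - u i) →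
     ∣ pattern′ p0 z (suc i) - z i - ½ * D ∣ ≤ ∣ pattern′ p0 z (suc i) - w - ½ * D ∣)

Greedy : ∀ {m} → (u v : Fin m → ℚ) → (D δ : ℚ) → ℚ → (Fin m → ℚ) → Set
Greedy u v D δ p0 z = ForwardGreedy u v D δ p0 z ⊎ BackwardGreedy u v D δ p0 z

Close : ∀ {m} → ℚ → ℚ → (Fin m → ℚ) → ℚ → (Fin m → ℚ) → Set
Close ε p0 z p0′ z′ = ∃ λ j → ∣ pattern′ p0 z j - pattern′ p0′ z′ j ∣ ≤ ε

SortingBy : (Fin 3 → ℚ) → Fin 3 → Fin 3 → Fin 3 → Set
SortingBy f i j k = (i ≢ j) × (j ≢ k) × (i ≢ k) × (f i ≤ f j) × (f j ≤ f k)

CyclicOf : Fin 3 → Fin 3 → Fin 3 → Fin 3 → Fin 3 → Fin 3 → Set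
CyclicOf i j k i′ j′ k′ =
  ((i′ ≡ i) × (j′ ≡ j) × (k′ ≡ k)) ⊎
  ((i′ ≡ j) × (j′ ≡ k) × (k′ ≡ i)) ⊎
  ((i′ ≡ k) × (j′ ≡ i) × (k′ ≡ j))

{-# OPTIONS --safe #-}
module Submission where

-- Suppose no two of the three patterns are e-close, e = ½δD: at every time any two of them are more
-- than e apart, so their relative order is well defined.  At a step with u_i + v_i ≤ δD = 2e two
-- patterns cannot swap.  At a step with u_i + v_i ≥ (1 - δ)D every pattern that moves up is below
-- every pattern that moves down before the step and above it afterwards; this is where greediness
-- enters, through the inequality a greedy choice imposes on the midpoint of its two candidates, the
-- strip [0, D], and the fact that two forward (or two backward) greedy patterns stay within D - e
-- of each other.  So at every step a pair swaps iff exactly one of its members is a pattern moving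
-- up across a large step, and the parity of the number of inverted pairs among the three patterns
-- is invariant: the order at the end is an even permutation, i.e. a cyclic shift, of the order at
-- the start.

open import Defs
open import Data.Nat using (ℕ; suc)
open import Data.Fin using (Fin; zero; suc; fromℕ; inject₁)
open import Data.Fin.Induction using (<-weakInduction; >-weakInduction)
open import Data.Fin.Properties using (all?; any?) renaming (_≟_ to _≟ᶠ_)
open import Data.Rational using (ℚ; _+_; _-_; -_; _*_; _≤_; _<_; ∣_∣; 0ℚ; 1ℚ; ½; positive)
open import Data.Rational.Properties
  using (_≟_; _≤?_; _<?_; +-*-commutativeRing; ∣-p∣≡∣p∣; ∣p∣≡p∨∣p∣≡-p; 0≤∣p∣; ≤-reflexive; ≤-trans; ≤-total;
         <⇒≤; <⇒≢; ≰⇒>; +-mono-≤; +-mono-<; +-mono-<-≤; +-monoˡ-≤; +-monoʳ-≤; +-monoˡ-<; +-monoʳ-<;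
         +-identityˡ; +-identityʳ; positive⁻¹; pos*pos⇒pos; module ≤-Reasoning)
open import Data.Bool using (Bool; true; false; not; _xor_; _∧_)
open import Data.Bool.Solver using (module xor-∧-Solver)
open import Data.Product using (_×_; _,_; proj₁; proj₂; ∃-syntax; swap)
open import Data.Sum using (_⊎_; inj₁; inj₂; [_,_]′)
open import Data.Empty using (⊥; ⊥-elim)
open import Data.List using (_∷_; [])
open import Function using (id; _∘_; const; case_of_)
open import Level using (0ℓ)
open import Relation.Binary.PropositionalEquality
  using (_≡_; _≢_; refl; sym; trans; cong; cong₂; subst; subst₂; module ≡-Reasoning)
open import Relation.Nullary using (¬_; Dec; yes; no; does; ¬?; _×-dec_; _⊎-dec_; _→-dec_)
open import Relation.Nullary.Decidable using (map′; dec-true; dec-false; dec⇒maybe; from-yes)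
open import Tactic.RingSolver using (solve; solve-∀)
import Tactic.RingSolver.Core.AlmostCommutativeRing as ACR

ℚ-ring : ACR.AlmostCommutativeRing 0ℓ 0ℓ
ℚ-ring = ACR.fromCommutativeRing +-*-commutativeRing (λ x → dec⇒maybe (0ℚ ≟ x))

-- Linear arithmetic throughout: sum the hypotheses into A ≤ B (or A < B) and read the goal off with
-- the ring solver; a contradiction is a strict sum A < B whose two sides are equal polynomials.
≤-rearrange : ∀ {A B L R : ℚ} → A ≤ B → L + B ≡ R + A → L ≤ R
≤-rearrange {A} {B} {L} {R} A≤B eq = begin
  L           ≡⟨ solve (L ∷ A ∷ []) ℚ-ring ⟩
  L + A - A   ≤⟨ +-monoˡ-≤ (- A) (+-monoʳ-≤ L A≤B) ⟩
  L + B - A   ≡⟨ cong (_- A) eq ⟩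
  R + A - A   ≡⟨ solve (R ∷ A ∷ []) ℚ-ring ⟩
  R           ∎
  where open ≤-Reasoning

<-rearrange : ∀ {A B L R : ℚ} → A < B → L + B ≡ R + A → L < R
<-rearrange {A} {B} {L} {R} A<B eq = begin-strict
  L           ≡⟨ solve (L ∷ A ∷ []) ℚ-ring ⟩
  L + A - A   <⟨ +-monoˡ-< (- A) (+-monoʳ-< L A<B) ⟩
  L + B - A   ≡⟨ cong (_- A) eq ⟩
  R + A - A   ≡⟨ solve (R ∷ A ∷ []) ℚ-ring ⟩
  R           ∎
  where open ≤-Reasoning

p≤∣p∣ : ∀ p → p ≤ ∣ p ∣
p≤∣p∣ p with ∣p∣≡p∨∣p∣≡-p p
... | inj₁ ∣p∣≡p  = ≤-reflexive (sym ∣p∣≡p)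
... | inj₂ ∣p∣≡-p = subst (p ≤_) (sym ∣p∣≡-p) (≤-rearrange (+-mono-≤ -p≥0 -p≥0) (solve (p ∷ []) ℚ-ring))
  where
  -p≥0 : 0ℚ ≤ - p
  -p≥0 = subst (0ℚ ≤_) ∣p∣≡-p (0≤∣p∣ p)

-p≤∣p∣ : ∀ p → - p ≤ ∣ p ∣
-p≤∣p∣ p = subst (- p ≤_) (∣-p∣≡∣p∣ p) (p≤∣p∣ (- p))

nearer-upper⇒p+q≤c+c : ∀ {p q} c → q < p → ∣ p - c ∣ ≤ ∣ q - c ∣ → p + q ≤ c + c
nearer-upper⇒p+q≤c+c {p} {q} c q<p nearer with ∣p∣≡p∨∣p∣≡-p (q - c) | ≤-trans (p≤∣p∣ (p - c)) nearer
... | inj₁ ∣q-c∣≡q-c  | p-c≤∣q-c∣ =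
  ⊥-elim (<⇒≢ (+-mono-<-≤ q<p (subst (p - c ≤_) ∣q-c∣≡q-c p-c≤∣q-c∣)) (solve (p ∷ q ∷ c ∷ []) ℚ-ring))
... | inj₂ ∣q-c∣≡-q-c | p-c≤∣q-c∣ =
  ≤-rearrange (subst (p - c ≤_) ∣q-c∣≡-q-c p-c≤∣q-c∣) (solve (p ∷ q ∷ c ∷ []) ℚ-ring)

nearer-lower⇒c+c≤p+q : ∀ {p q} c → p < q → ∣ p - c ∣ ≤ ∣ q - c ∣ → c + c ≤ p + q
nearer-lower⇒c+c≤p+q {p} {q} c p<q nearer with ∣p∣≡p∨∣p∣≡-p (q - c) | ≤-trans (-p≤∣p∣ (p - c)) nearer
... | inj₁ ∣q-c∣≡q-c  | c-p≤∣q-c∣ =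
  ≤-rearrange (subst (- (p - c) ≤_) ∣q-c∣≡q-c c-p≤∣q-c∣) (solve (p ∷ q ∷ c ∷ []) ℚ-ring)
... | inj₂ ∣q-c∣≡-q-c | c-p≤∣q-c∣ =
  ⊥-elim (<⇒≢ (+-mono-<-≤ p<q (subst (- (p - c) ≤_) ∣q-c∣≡-q-c c-p≤∣q-c∣)) (solve (p ∷ q ∷ c ∷ []) ℚ-ring))

∣x-y∣>e⇒ordered : ∀ {e} x y → e < ∣ x - y ∣ → e < y - x ⊎ e < x - y
∣x-y∣>e⇒ordered {e} x y e<∣x-y∣ with ∣p∣≡p∨∣p∣≡-p (x - y)
... | inj₁ eq = inj₂ (subst (e <_) eq e<∣x-y∣)
... | inj₂ eq = inj₁ (subst (e <_) (trans eq (solve (x ∷ y ∷ []) ℚ-ring)) e<∣x-y∣)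

gap-irrefl : ∀ {e} x → 0ℚ < e → ¬ e < x - x
gap-irrefl {e} x e>0 e<0 = <⇒≢ (+-mono-< e>0 e<0) (solve (e ∷ x ∷ []) ℚ-ring)

gap-trans : ∀ {e} x y w → 0ℚ < e → e < y - x → e < w - y → e < w - x
gap-trans {e} x y w e>0 x≺y y≺w =
  <-rearrange (+-mono-< (+-mono-< x≺y y≺w) e>0) (solve (e ∷ x ∷ y ∷ w ∷ []) ℚ-ring)

≤⇒¬gap : ∀ {e} x y → 0ℚ < e → x ≤ y → ¬ e < x - y
≤⇒¬gap {e} x y e>0 x≤y y≺x = <⇒≢ (+-mono-<-≤ (+-mono-< e>0 y≺x) x≤y) (solve (e ∷ x ∷ y ∷ []) ℚ-ring)

x-u<x+v : ∀ x {u v} → 0ℚ < u → 0ℚ < v → x - u < x + v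
x-u<x+v x {u} {v} u>0 v>0 = <-rearrange (+-mono-< u>0 v>0) (solve (x ∷ u ∷ v ∷ []) ℚ-ring)

x-v<x--u : ∀ x {u v} → 0ℚ < u → 0ℚ < v → x - v < x - - u
x-v<x--u x {u} {v} u>0 v>0 = <-rearrange (+-mono-< u>0 v>0) (solve (x ∷ u ∷ v ∷ []) ℚ-ring)

x-u≤x : ∀ x {u} → 0ℚ < u → x - u ≤ x
x-u≤x x {u} u>0 = ≤-rearrange (<⇒≤ u>0) (solve (x ∷ u ∷ []) ℚ-ring)

x≤x+v : ∀ x {v} → 0ℚ < v → x ≤ x + v
x≤x+v x {v} v>0 = ≤-rearrange (<⇒≤ v>0) (solve (x ∷ v ∷ []) ℚ-ring)

difference-shift : ∀ x y t → (y + t) - (x + t) ≡ y - x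
difference-shift = solve-∀ ℚ-ring

*-pos : ∀ {p q} → 0ℚ < p → 0ℚ < q → 0ℚ < p * q
*-pos {p} {q} p>0 q>0 = positive⁻¹ (p * q) {{pos*pos⇒pos p {{positive p>0}} q {{positive q>0}}}}

pattern′-step : ∀ {n} p (w : Fin n → ℚ) i → pattern′ p w (suc i) ≡ pattern′ p w (inject₁ i) + w i
pattern′-step {suc n} p w zero    = refl
pattern′-step {suc n} p w (suc i) = pattern′-step (p + w zero) (w ∘ suc) i

close? : ∀ {m} ε p (w : Fin m → ℚ) p′ w′ → Dec (Close ε p w p′ w′)
close? ε p w p′ w′ = any? λ j → ∣ pattern′ p w j - pattern′ p′ w′ j ∣ ≤? ε

close-pair? : ∀ {m} ε (p0 : Fin 3 → ℚ) (z : Fin 3 → Fin m → ℚ) →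
  Dec (∃[ a ] ∃[ b ] ((a ≢ b) × Close ε (p0 a) (z a) (p0 b) (z b)))
close-pair? ε p0 z = any? λ a → any? λ b → ¬? (a ≟ᶠ b) ×-dec close? ε (p0 a) (z a) (p0 b) (z b)

xor-flips-cancel : ∀ fa fb fc x y w →
  ((fa xor fb) xor x) xor (((fb xor fc) xor y) xor ((fa xor fc) xor w)) ≡ x xor (y xor w)
xor-flips-cancel = xor-∧-Solver.solve 6 (λ fa fb fc x y w →
  ((fa :+ fb) :+ x) :+ (((fb :+ fc) :+ y) :+ ((fa :+ fc) :+ w)) := x :+ (y :+ w)) refl
  where open xor-∧-Solver using (_:+_; _:=_)

DistinctTriplesCoverFin3 : Set
DistinctTriplesCoverFin3 = ∀ (a b c x : Fin 3) → a ≢ b → b ≢ c → a ≢ c → x ≡ a ⊎ x ≡ b ⊎ x ≡ c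

-- Decided by evaluation; opaque, so that uses do not evaluate the decision procedure again.
opaque
  distinct-triples-cover-Fin3 : DistinctTriplesCoverFin3
  distinct-triples-cover-Fin3 = from-yes covers?
    where
    covers? : Dec DistinctTriplesCoverFin3
    covers? = all? λ a → all? λ b → all? λ c → all? λ x →
      ¬? (a ≟ᶠ b) →-dec (¬? (b ≟ᶠ c) →-dec (¬? (a ≟ᶠ c) →-dec (x ≟ᶠ a ⊎-dec x ≟ᶠ b ⊎-dec x ≟ᶠ c)))

CyclicallyOrdered : (Fin 3 → Fin 3 → Set) → Fin 3 → Fin 3 → Fin 3 → Set
CyclicallyOrdered _⊏_ a b c = (a ⊏ b × b ⊏ c) ⊎ (b ⊏ c × c ⊏ a) ⊎ (c ⊏ a × a ⊏ b)

module CyclicOrder (_⊏_ : Fin 3 → Fin 3 → Set)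
  (⊏-irrefl : ∀ {a} → ¬ a ⊏ a) (⊏-trans : ∀ {a b c} → a ⊏ b → b ⊏ c → a ⊏ c) where

  ⊏⇒≢ : ∀ {a b} → a ⊏ b → a ≢ b
  ⊏⇒≢ a⊏b refl = ⊏-irrefl a⊏b

  covers : ∀ {a b c} → a ⊏ b → b ⊏ c → ∀ x → x ≡ a ⊎ x ≡ b ⊎ x ≡ c
  covers a⊏b b⊏c x = distinct-triples-cover-Fin3 _ _ _ x (⊏⇒≢ a⊏b) (⊏⇒≢ b⊏c) (⊏⇒≢ (⊏-trans a⊏b b⊏c))

  least : ∀ {a b c} → a ⊏ b → b ⊏ c → ∀ x → x ≡ a ⊎ a ⊏ x
  least a⊏b b⊏c x with covers a⊏b b⊏c x
  ... | inj₁ x≡a         = inj₁ x≡a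
  ... | inj₂ (inj₁ refl) = inj₂ a⊏b
  ... | inj₂ (inj₂ refl) = inj₂ (⊏-trans a⊏b b⊏c)

  greatest : ∀ {a b c} → a ⊏ b → b ⊏ c → ∀ x → x ≡ c ⊎ x ⊏ c
  greatest a⊏b b⊏c x with covers a⊏b b⊏c x
  ... | inj₁ refl        = inj₂ (⊏-trans a⊏b b⊏c)
  ... | inj₂ (inj₁ refl) = inj₂ b⊏c
  ... | inj₂ (inj₂ x≡c)  = inj₁ x≡c

  sorting-unique : ∀ {a b c a′ b′ c′} → a ⊏ b → b ⊏ c → a′ ⊏ b′ → b′ ⊏ c′ → a′ ≡ a × b′ ≡ b × c′ ≡ c
  sorting-unique {a} {b} {c} {a′} {b′} {c′} a⊏b b⊏c a′⊏b′ b′⊏c′ = a′≡a , b′≡b , c′≡c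
    where
    a′≡a : a′ ≡ a
    a′≡a with least a⊏b b⊏c a′ | least a′⊏b′ b′⊏c′ a
    ... | inj₁ a′≡a | _         = a′≡a
    ... | inj₂ _    | inj₁ a≡a′ = sym a≡a′
    ... | inj₂ a⊏a′ | inj₂ a′⊏a = ⊥-elim (⊏-irrefl (⊏-trans a⊏a′ a′⊏a))

    c′≡c : c′ ≡ c
    c′≡c with greatest a⊏b b⊏c c′ | greatest a′⊏b′ b′⊏c′ c
    ... | inj₁ c′≡c | _         = c′≡c
    ... | inj₂ _    | inj₁ c≡c′ = sym c≡c′
    ... | inj₂ c′⊏c | inj₂ c⊏c′ = ⊥-elim (⊏-irrefl (⊏-trans c′⊏c c⊏c′))

    b′≡b : b′ ≡ b
    b′≡b with covers a⊏b b⊏c b′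
    ... | inj₁ b′≡a        = ⊥-elim (⊏-irrefl (subst₂ _⊏_ a′≡a b′≡a a′⊏b′))
    ... | inj₂ (inj₁ b′≡b) = b′≡b
    ... | inj₂ (inj₂ b′≡c) = ⊥-elim (⊏-irrefl (subst₂ _⊏_ b′≡c c′≡c b′⊏c′))

  cyclic⇒CyclicOf : ∀ {a b c a′ b′ c′} →
    CyclicallyOrdered _⊏_ a b c → a′ ⊏ b′ → b′ ⊏ c′ → CyclicOf a b c a′ b′ c′
  cyclic⇒CyclicOf (inj₁ (a⊏b , b⊏c))        a′⊏b′ b′⊏c′ = inj₁ (sorting-unique a⊏b b⊏c a′⊏b′ b′⊏c′)
  cyclic⇒CyclicOf (inj₂ (inj₁ (b⊏c , c⊏a))) a′⊏b′ b′⊏c′ = inj₂ (inj₁ (sorting-unique b⊏c c⊏a a′⊏b′ b′⊏c′))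
  cyclic⇒CyclicOf (inj₂ (inj₂ (c⊏a , a⊏b))) a′⊏b′ b′⊏c′ = inj₂ (inj₂ (sorting-unique c⊏a a⊏b a′⊏b′ b′⊏c′))

module SeparatedGreedyTriple
  (m : ℕ) (u v : Fin (suc m) → ℚ) (D δ : ℚ)
  (u>0 : ∀ i → 0ℚ < u i) (v>0 : ∀ i → 0ℚ < v i) (d≤D : ∀ i → u i + v i ≤ D)
  (e>0 : 0ℚ < ½ * δ * D)
  (sizes : ∀ i → InInterval 0ℚ (δ * D) (u i + v i) ⊎ InInterval ((1ℚ - δ) * D) D (u i + v i))
  (p0 : Fin 3 → ℚ) (z : Fin 3 → Fin (suc m) → ℚ)
  (greedy : ∀ a → Greedy u v D δ (p0 a) (z a))
  (strip : ∀ a → LivesOnStrip D (p0 a) (z a))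
  (apart : ∀ a b → a ≢ b → ¬ Close (½ * δ * D) (p0 a) (z a) (p0 b) (z b))
  where

  e : ℚ
  e = ½ * δ * D

  Time : Set
  Time = Fin (suc (suc m))

  end : Time
  end = fromℕ (suc m)

  X : Fin 3 → Time → ℚ
  X a = pattern′ (p0 a) (z a)

  variable
    a b c : Fin 3
    i : Fin (suc m)
    k : Time

  -- A record rather than a synonym for the inequality, so that a, k and b can be inferred.
  record _≺[_]_ (a : Fin 3) (k : Time) (b : Fin 3) : Set where
    constructor gap
    field exceeds : e < X b k - X a k

  open _≺[_]_ using (exceeds)

  ≺-irrefl : ¬ a ≺[ k ] a
  ≺-irrefl {a} {k} (gap a≺a) = gap-irrefl (X a k) e>0 a≺a

  ≺-trans : a ≺[ k ] b → b ≺[ k ] c → a ≺[ k ] c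
  ≺-trans {a} {k} {b} {c} (gap a≺b) (gap b≺c) = gap (gap-trans (X a k) (X b k) (X c k) e>0 a≺b b≺c)

  ≺-total : a ≢ b → a ≺[ k ] b ⊎ b ≺[ k ] a
  ≺-total {a} {b} {k} a≢b with ∣x-y∣>e⇒ordered (X a k) (X b k) (≰⇒> λ close → apart a b a≢b (k , close))
  ... | inj₁ a≺b = inj₁ (gap a≺b)
  ... | inj₂ b≺a = inj₂ (gap b≺a)

  ¬≻⇒≺ : a ≢ b → ¬ b ≺[ k ] a → a ≺[ k ] b
  ¬≻⇒≺ a≢b b⊀a = [ id , ⊥-elim ∘ b⊀a ]′ (≺-total a≢b)

  ≤⇒≺ : a ≢ b → X a k ≤ X b k → a ≺[ k ] b
  ≤⇒≺ {a} {b} {k} a≢b xa≤xb = ¬≻⇒≺ a≢b λ (gap b≺a) → ≤⇒¬gap (X a k) (X b k) e>0 xa≤xb b≺a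

  _≺?[_]_ : ∀ a k b → Dec (a ≺[ k ] b)
  a ≺?[ k ] b = map′ gap exceeds (e <? X b k - X a k)

  below : Fin 3 → Fin 3 → Time → Bool
  below a b k = does (a ≺?[ k ] b)

  below-true : a ≺[ k ] b → below a b k ≡ true
  below-true {a} {k} {b} = dec-true (a ≺?[ k ] b)

  below-false : b ≺[ k ] a → below a b k ≡ false
  below-false {b} {k} {a} b≺a = dec-false (a ≺?[ k ] b) (λ a≺b → ≺-irrefl (≺-trans a≺b b≺a))

  move : ∀ a i → z a i ≡ v i ⊎ z a i ≡ - u i
  move a = [ proj₁ , proj₁ ]′ (greedy a)

  step-up : z a i ≡ v i → X a (suc i) ≡ X a (inject₁ i) + v i
  step-up {a} {i} a↑ = trans (pattern′-step (p0 a) (z a) i) (cong (X a (inject₁ i) +_) a↑)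

  step-down : z a i ≡ - u i → X a (suc i) ≡ X a (inject₁ i) - u i
  step-down {a} {i} a↓ = trans (pattern′-step (p0 a) (z a) i) (cong (X a (inject₁ i) +_) a↓)

  same-move-gap : z a i ≡ z b i → X b (suc i) - X a (suc i) ≡ X b (inject₁ i) - X a (inject₁ i)
  same-move-gap {a} {i} {b} za≡zb = begin
    X b (suc i) - X a (suc i)
      ≡⟨ cong₂ _-_ (pattern′-step (p0 b) (z b) i) (pattern′-step (p0 a) (z a) i) ⟩
    (X b (inject₁ i) + z b i) - (X a (inject₁ i) + z a i)
      ≡⟨ cong (λ t → (X b (inject₁ i) + z b i) - (X a (inject₁ i) + t)) za≡zb ⟩
    (X b (inject₁ i) + z b i) - (X a (inject₁ i) + z b i)
      ≡⟨ difference-shift (X a (inject₁ i)) (X b (inject₁ i)) (z b i) ⟩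
    X b (inject₁ i) - X a (inject₁ i) ∎
    where open ≡-Reasoning

  Small Large : Fin (suc m) → Set
  Small i = u i + v i ≤ e + e
  Large i = D ≤ (u i + v i) + (e + e)

  small-or-large : ∀ i → Small i ⊎ Large i
  small-or-large i with sizes i
  ... | inj₁ (_ , d≤δD)     = inj₁ (subst (u i + v i ≤_) (δD≡e+e δ D) d≤δD)
    where
    δD≡e+e : ∀ δ D → δ * D ≡ ½ * δ * D + ½ * δ * D
    δD≡e+e = solve-∀ ℚ-ring
  ... | inj₂ (d≥[1-δ]D , _) = inj₂ (≤-rearrange d≥[1-δ]D (regroup (u i + v i) δ D))
    where
    regroup : ∀ d δ D → D + d ≡ (d + (½ * δ * D + ½ * δ * D)) + (1ℚ - δ) * D
    regroup = solve-∀ ℚ-ring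

  Forward Backward : Fin 3 → Set
  Forward a  = ForwardGreedy u v D δ (p0 a) (z a)
  Backward a = BackwardGreedy u v D δ (p0 a) (z a)

  ½D+½D≡D : ½ * D + ½ * D ≡ D
  ½D+½D≡D = solve (D ∷ []) ℚ-ring

  -- A greedy step leaves ½ D on the chosen candidate's side of the midpoint of the two candidates;
  -- for a forward step this holds also when the rejected candidate leaves [0, D].
  forward-up : Forward a → z a i ≡ v i → X a (suc i) + (X a (inject₁ i) - u i) ≤ D
  forward-up {a} {i} (_ , _ , greedy-step) a↑ with ≤-total 0ℚ (X a (inject₁ i) - u i)
  ... | inj₁ 0≤x-u = subst (X a (suc i) + (X a (inject₁ i) - u i) ≤_) ½D+½D≡D
          (nearer-upper⇒p+q≤c+c (½ * D) x-u<y (proj₂ (greedy-step i) (- u i) (inj₂ refl) (0≤x-u , x-u≤D)))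
    where
    x-u<y : X a (inject₁ i) - u i < X a (suc i)
    x-u<y = subst (X a (inject₁ i) - u i <_) (sym (step-up a↑)) (x-u<x+v (X a (inject₁ i)) (u>0 i) (v>0 i))
    x-u≤D : X a (inject₁ i) - u i ≤ D
    x-u≤D = ≤-trans (x-u≤x (X a (inject₁ i)) (u>0 i)) (proj₂ (strip a (inject₁ i)))
  ... | inj₂ x-u≤0 = subst (X a (suc i) + (X a (inject₁ i) - u i) ≤_) (+-identityʳ D)
          (+-mono-≤ (proj₂ (strip a (suc i))) x-u≤0)

  forward-down : Forward a → z a i ≡ - u i → D ≤ X a (suc i) + (X a (inject₁ i) + v i)
  forward-down {a} {i} (_ , _ , greedy-step) a↓ with ≤-total (X a (inject₁ i) + v i) D
  ... | inj₁ x+v≤D = subst (_≤ X a (suc i) + (X a (inject₁ i) + v i)) ½D+½D≡D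
          (nearer-lower⇒c+c≤p+q (½ * D) y<x+v (proj₂ (greedy-step i) (v i) (inj₁ refl) (0≤x+v , x+v≤D)))
    where
    y<x+v : X a (suc i) < X a (inject₁ i) + v i
    y<x+v = subst (_< X a (inject₁ i) + v i) (sym (step-down a↓)) (x-u<x+v (X a (inject₁ i)) (u>0 i) (v>0 i))
    0≤x+v : 0ℚ ≤ X a (inject₁ i) + v i
    0≤x+v = ≤-trans (proj₁ (strip a (inject₁ i))) (x≤x+v (X a (inject₁ i)) (v>0 i))
  ... | inj₂ D≤x+v = subst (_≤ X a (suc i) + (X a (inject₁ i) + v i)) (+-identityˡ D)
          (+-mono-≤ (proj₁ (strip a (suc i))) D≤x+v)

  backward-up : Backward a → z a i ≡ v i → D ≤ (X a (suc i) - v i) + (X a (suc i) - - u i)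
  backward-up {a} {i} (_ , _ , greedy-step) a↑ =
    subst (_≤ (X a (suc i) - v i) + (X a (suc i) - - u i)) ½D+½D≡D
      (nearer-lower⇒c+c≤p+q (½ * D) (x-v<x--u (X a (suc i)) (u>0 i) (v>0 i))
        (subst (λ w → ∣ X a (suc i) - w - ½ * D ∣ ≤ ∣ X a (suc i) - - u i - ½ * D ∣) a↑
          (greedy-step i (- u i) (inj₂ refl))))

  backward-down : Backward a → z a i ≡ - u i → (X a (suc i) - - u i) + (X a (suc i) - v i) ≤ D
  backward-down {a} {i} (_ , _ , greedy-step) a↓ =
    subst ((X a (suc i) - - u i) + (X a (suc i) - v i) ≤_) ½D+½D≡D
      (nearer-upper⇒p+q≤c+c (½ * D) (x-v<x--u (X a (suc i)) (u>0 i) (v>0 i))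
        (subst (λ w → ∣ X a (suc i) - w - ½ * D ∣ ≤ ∣ X a (suc i) - v i - ½ * D ∣) a↓
          (greedy-step i (v i) (inj₁ refl))))

  OrderKept : Fin 3 → Fin 3 → Fin (suc m) → Set
  OrderKept a b i = (a ≺[ inject₁ i ] b → a ≺[ suc i ] b) × (b ≺[ inject₁ i ] a → b ≺[ suc i ] a)

  same-move-kept : z a i ≡ z b i → OrderKept a b i
  same-move-kept za≡zb =
    (λ (gap a≺b) → gap (subst (e <_) (sym (same-move-gap za≡zb)) a≺b)) ,
    (λ (gap b≺a) → gap (subst (e <_) (sym (same-move-gap (sym za≡zb))) b≺a))

  up-down-keeps-≻ : z a i ≡ v i → z b i ≡ - u i → b ≺[ inject₁ i ] a → b ≺[ suc i ] a
  up-down-keeps-≻ {a} {i} {b} a↑ b↓ (gap b≺a) =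
    gap (widen (X a (inject₁ i)) (X b (inject₁ i)) (u>0 i) (v>0 i) (step-up a↑) (step-down b↓) b≺a)
    where
    widen : ∀ {e u v} xa xb {ya yb} → 0ℚ < u → 0ℚ < v → ya ≡ xa + v → yb ≡ xb - u →
      e < xa - xb → e < ya - yb
    widen {e} {u} {v} xa xb u>0 v>0 refl refl b≺a =
      <-rearrange (+-mono-< b≺a (+-mono-< u>0 v>0)) (solve (e ∷ u ∷ v ∷ xa ∷ xb ∷ []) ℚ-ring)

  small-up-down-kept : Small i → a ≢ b → z a i ≡ v i → z b i ≡ - u i → OrderKept a b i
  small-up-down-kept {i} {a} {b} small a≢b a↑ b↓ = keeps-≺ , up-down-keeps-≻ a↑ b↓
    where
    no-crossing : ∀ {e u v} xa xb {ya yb} → u + v ≤ e + e → ya ≡ xa + v → yb ≡ xb - u →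
      e < xb - xa → e < ya - yb → ⊥
    no-crossing {e} {u} {v} xa xb small refl refl a≺b b≺a =
      <⇒≢ (+-mono-<-≤ (+-mono-< a≺b b≺a) small) (solve (e ∷ u ∷ v ∷ xa ∷ xb ∷ []) ℚ-ring)
    keeps-≺ : a ≺[ inject₁ i ] b → a ≺[ suc i ] b
    keeps-≺ (gap a≺b) = ¬≻⇒≺ a≢b λ (gap b≺a) →
      no-crossing (X a (inject₁ i)) (X b (inject₁ i)) small (step-up a↑) (step-down b↓) a≺b b≺a

  small-keeps-order : Small i → a ≢ b → OrderKept a b i
  small-keeps-order {i} {a} {b} small a≢b with move a i | move b i
  ... | inj₁ a↑ | inj₁ b↑ = same-move-kept (trans a↑ (sym b↑))
  ... | inj₂ a↓ | inj₂ b↓ = same-move-kept (trans a↓ (sym b↓))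
  ... | inj₁ a↑ | inj₂ b↓ = small-up-down-kept small a≢b a↑ b↓
  ... | inj₂ a↓ | inj₁ b↑ = swap (small-up-down-kept small (a≢b ∘ sym) b↑ a↓)

  Near : Fin 3 → Fin 3 → Time → Set
  Near a b k = X a k - X b k ≤ D - e × X b k - X a k ≤ D - e

  margins⇒near : InInterval (¼ * δ * D) ((1ℚ - ¼ * δ) * D) (X a k) →
                 InInterval (¼ * δ * D) ((1ℚ - ¼ * δ) * D) (X b k) → Near a b k
  margins⇒near (a≥ , a≤) (b≥ , b≤) = at-most a≤ b≥ , at-most b≤ a≥
    where
    regroup : ∀ p q δ D → p - q + ((1ℚ - ¼ * δ) * D + q) ≡ D - ½ * δ * D + (p + ¼ * δ * D)
    regroup = solve-∀ ℚ-ring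
    at-most : ∀ {p q} → p ≤ (1ℚ - ¼ * δ) * D → ¼ * δ * D ≤ q → p - q ≤ D - e
    at-most {p} {q} p≤ q≥ = ≤-rearrange (+-mono-≤ p≤ q≥) (regroup p q δ D)

  same-move-near : z a i ≡ z b i → Near a b (suc i) ≡ Near a b (inject₁ i)
  same-move-near za≡zb =
    cong₂ _×_ (cong (_≤ D - e) (same-move-gap (sym za≡zb))) (cong (_≤ D - e) (same-move-gap za≡zb))

  forward-up-down-≺ : Forward a → Forward b → a ≢ b → z a i ≡ v i → z b i ≡ - u i → a ≺[ inject₁ i ] b
  forward-up-down-≺ {a} {b} {i} Fa Fb a≢b a↑ b↓ = ¬≻⇒≺ a≢b λ (gap b≺a) →
    midpoints-ordered (X a (inject₁ i)) (X b (inject₁ i)) e>0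
      (forward-up Fa a↑) (forward-down Fb b↓) (step-up a↑) (step-down b↓) b≺a
    where
    midpoints-ordered : ∀ {e u v D} xa xb {ya yb} → 0ℚ < e → ya + (xa - u) ≤ D → D ≤ yb + (xb + v) →
      ya ≡ xa + v → yb ≡ xb - u → e < xa - xb → ⊥
    midpoints-ordered {e} {u} {v} {D} xa xb e>0 fa fb refl refl b≺a =
      <⇒≢ (+-mono-<-≤ (+-mono-<-≤ (+-mono-< (+-mono-< b≺a b≺a) (+-mono-< e>0 e>0)) fa) fb)
          (solve (e ∷ u ∷ v ∷ D ∷ xa ∷ xb ∷ []) ℚ-ring)

  forward-near-up-down : Forward a → Forward b → a ≢ b → z a i ≡ v i → z b i ≡ - u i →
    Near a b (inject₁ i) → Near a b (suc i)
  forward-near-up-down {a} {b} {i} Fa Fb a≢b a↑ b↓ (_ , near-ba) =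
    ahead (X a (inject₁ i)) (X b (inject₁ i)) (d≤D i) (step-up a↑) (step-down b↓)
      (exceeds (forward-up-down-≺ Fa Fb a≢b a↑ b↓)) ,
    behind (X a (inject₁ i)) (X b (inject₁ i)) (u>0 i) (v>0 i) (step-up a↑) (step-down b↓) near-ba
    where
    ahead : ∀ {e u v D} xa xb {ya yb} → u + v ≤ D → ya ≡ xa + v → yb ≡ xb - u →
      e < xb - xa → ya - yb ≤ D - e
    ahead {e} {u} {v} {D} xa xb d≤D refl refl a≺b =
      ≤-rearrange (+-mono-≤ (<⇒≤ a≺b) d≤D) (solve (e ∷ u ∷ v ∷ D ∷ xa ∷ xb ∷ []) ℚ-ring)
    behind : ∀ {c u v} xa xb {ya yb} → 0ℚ < u → 0ℚ < v → ya ≡ xa + v → yb ≡ xb - u →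
      xb - xa ≤ c → yb - ya ≤ c
    behind {c} {u} {v} xa xb u>0 v>0 refl refl near =
      ≤-rearrange (+-mono-≤ near (<⇒≤ (+-mono-< u>0 v>0))) (solve (c ∷ u ∷ v ∷ xa ∷ xb ∷ []) ℚ-ring)

  forward-near-step : Forward a → Forward b → a ≢ b → ∀ i → Near a b (inject₁ i) → Near a b (suc i)
  forward-near-step {a} {b} Fa Fb a≢b i with move a i | move b i
  ... | inj₁ a↑ | inj₁ b↑ = subst id (sym (same-move-near (trans a↑ (sym b↑))))
  ... | inj₂ a↓ | inj₂ b↓ = subst id (sym (same-move-near (trans a↓ (sym b↓))))
  ... | inj₁ a↑ | inj₂ b↓ = forward-near-up-down Fa Fb a≢b a↑ b↓
  ... | inj₂ a↓ | inj₁ b↑ = swap ∘ forward-near-up-down Fb Fa (a≢b ∘ sym) b↑ a↓ ∘ swap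

  forward-near : Forward a → Forward b → a ≢ b → ∀ k → Near a b k
  forward-near {a} {b} Fa Fb a≢b =
    <-weakInduction (Near a b) (margins⇒near {a = a} {k = zero} {b = b} (proj₁ (proj₂ Fa)) (proj₁ (proj₂ Fb)))
      (forward-near-step Fa Fb a≢b)

  backward-up-down-≻ : Backward a → Backward b → a ≢ b → z a i ≡ v i → z b i ≡ - u i → b ≺[ suc i ] a
  backward-up-down-≻ {a} {b} {i} Ba Bb a≢b a↑ b↓ = ¬≻⇒≺ (a≢b ∘ sym) λ (gap a≺b) →
    midpoints-ordered (X a (suc i)) (X b (suc i)) e>0 (backward-up Ba a↑) (backward-down Bb b↓) a≺b
    where
    midpoints-ordered : ∀ {e u v D} ya yb → 0ℚ < e → D ≤ (ya - v) + (ya - - u) →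
      (yb - - u) + (yb - v) ≤ D → e < yb - ya → ⊥
    midpoints-ordered {e} {u} {v} {D} ya yb e>0 ba bb a≺b =
      <⇒≢ (+-mono-<-≤ (+-mono-<-≤ (+-mono-< (+-mono-< a≺b a≺b) (+-mono-< e>0 e>0)) ba) bb)
          (solve (e ∷ u ∷ v ∷ D ∷ ya ∷ yb ∷ []) ℚ-ring)

  backward-near-up-down : Backward a → Backward b → a ≢ b → z a i ≡ v i → z b i ≡ - u i →
    Near a b (suc i) → Near a b (inject₁ i)
  backward-near-up-down {a} {b} {i} Ba Bb a≢b a↑ b↓ (near-ab , _) =
    behind (X a (inject₁ i)) (X b (inject₁ i)) (u>0 i) (v>0 i) (step-up a↑) (step-down b↓) near-ab ,
    ahead (X a (inject₁ i)) (X b (inject₁ i)) (d≤D i) (step-up a↑) (step-down b↓)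
      (exceeds (backward-up-down-≻ Ba Bb a≢b a↑ b↓))
    where
    behind : ∀ {c u v} xa xb {ya yb} → 0ℚ < u → 0ℚ < v → ya ≡ xa + v → yb ≡ xb - u →
      ya - yb ≤ c → xa - xb ≤ c
    behind {c} {u} {v} xa xb u>0 v>0 refl refl near =
      ≤-rearrange (+-mono-≤ near (<⇒≤ (+-mono-< u>0 v>0))) (solve (c ∷ u ∷ v ∷ xa ∷ xb ∷ []) ℚ-ring)
    ahead : ∀ {e u v D} xa xb {ya yb} → u + v ≤ D → ya ≡ xa + v → yb ≡ xb - u →
      e < ya - yb → xb - xa ≤ D - e
    ahead {e} {u} {v} {D} xa xb d≤D refl refl b≺a =
      ≤-rearrange (+-mono-≤ (<⇒≤ b≺a) d≤D) (solve (e ∷ u ∷ v ∷ D ∷ xa ∷ xb ∷ []) ℚ-ring)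

  backward-near-step : Backward a → Backward b → a ≢ b → ∀ i → Near a b (suc i) → Near a b (inject₁ i)
  backward-near-step {a} {b} Ba Bb a≢b i with move a i | move b i
  ... | inj₁ a↑ | inj₁ b↑ = subst id (same-move-near (trans a↑ (sym b↑)))
  ... | inj₂ a↓ | inj₂ b↓ = subst id (same-move-near (trans a↓ (sym b↓)))
  ... | inj₁ a↑ | inj₂ b↓ = backward-near-up-down Ba Bb a≢b a↑ b↓
  ... | inj₂ a↓ | inj₁ b↑ = swap ∘ backward-near-up-down Bb Ba (a≢b ∘ sym) b↑ a↓ ∘ swap

  backward-near : Backward a → Backward b → a ≢ b → ∀ k → Near a b k
  backward-near {a} {b} Ba Bb a≢b =
    >-weakInduction (Near a b) (margins⇒near {a = a} {k = end} {b = b} (proj₁ (proj₂ Ba)) (proj₁ (proj₂ Bb)))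
      (backward-near-step Ba Bb a≢b)

  large-up-down-before : Large i → a ≢ b → z a i ≡ v i → z b i ≡ - u i → a ≺[ inject₁ i ] b
  large-up-down-before {i} {a} {b} large a≢b a↑ b↓ = ¬≻⇒≺ a≢b not-above
    where
    xa xb : ℚ
    xa = X a (inject₁ i)
    xb = X b (inject₁ i)
    a-forward : ∀ {e u v D} xa xb {ya yb} → D ≤ (u + v) + (e + e) → ya + (xa - u) ≤ D → 0ℚ ≤ yb →
      ya ≡ xa + v → yb ≡ xb - u → e < xa - xb → ⊥
    a-forward {e} {u} {v} {D} xa xb large fa yb≥0 refl refl b≺a =
      <⇒≢ (+-mono-<-≤ (+-mono-<-≤ (+-mono-<-≤ (+-mono-< b≺a b≺a) fa) (+-mono-≤ yb≥0 yb≥0)) large)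
          (solve (e ∷ u ∷ v ∷ D ∷ xa ∷ xb ∷ []) ℚ-ring)
    b-forward : ∀ {e u v D} xa xb {ya yb} → D ≤ (u + v) + (e + e) → D ≤ yb + (xb + v) → ya ≤ D →
      ya ≡ xa + v → yb ≡ xb - u → e < xa - xb → ⊥
    b-forward {e} {u} {v} {D} xa xb large fb ya≤D refl refl b≺a =
      <⇒≢ (+-mono-<-≤ (+-mono-<-≤ (+-mono-<-≤ (+-mono-< b≺a b≺a) fb) (+-mono-≤ ya≤D ya≤D)) large)
          (solve (e ∷ u ∷ v ∷ D ∷ xa ∷ xb ∷ []) ℚ-ring)
    both-backward : ∀ {e u v D} xa xb {ya yb} → D ≤ (u + v) + (e + e) → ya - yb ≤ D - e →
      ya ≡ xa + v → yb ≡ xb - u → e < xa - xb → ⊥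
    both-backward {e} {u} {v} {D} xa xb large near refl refl b≺a =
      <⇒≢ (+-mono-<-≤ (+-mono-<-≤ b≺a near) large) (solve (e ∷ u ∷ v ∷ D ∷ xa ∷ xb ∷ []) ℚ-ring)
    not-above : ¬ b ≺[ inject₁ i ] a
    not-above (gap b≺a) with greedy a | greedy b
    ... | inj₁ Fa | _ =
      a-forward xa xb large (forward-up Fa a↑) (proj₁ (strip b (suc i))) (step-up a↑) (step-down b↓) b≺a
    ... | inj₂ _ | inj₁ Fb =
      b-forward xa xb large (forward-down Fb b↓) (proj₂ (strip a (suc i))) (step-up a↑) (step-down b↓) b≺a
    ... | inj₂ Ba | inj₂ Bb =
      both-backward xa xb large (proj₁ (backward-near Ba Bb a≢b (suc i))) (step-up a↑) (step-down b↓) b≺a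

  large-up-down-after : Large i → a ≢ b → z a i ≡ v i → z b i ≡ - u i → b ≺[ suc i ] a
  large-up-down-after {i} {a} {b} large a≢b a↑ b↓ = ¬≻⇒≺ (a≢b ∘ sym) not-below
    where
    xa xb : ℚ
    xa = X a (inject₁ i)
    xb = X b (inject₁ i)
    a-backward : ∀ {e u v D} xa xb {ya yb} → D ≤ (u + v) + (e + e) → D ≤ (ya - v) + (ya - - u) → xb ≤ D →
      ya ≡ xa + v → yb ≡ xb - u → e < yb - ya → ⊥
    a-backward {e} {u} {v} {D} xa xb large ba xb≤D refl refl a≺b =
      <⇒≢ (+-mono-<-≤ (+-mono-<-≤ (+-mono-<-≤ (+-mono-< a≺b a≺b) ba) (+-mono-≤ xb≤D xb≤D)) large)
          (solve (e ∷ u ∷ v ∷ D ∷ xa ∷ xb ∷ []) ℚ-ring)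
    b-backward : ∀ {e u v D} xa xb {ya yb} → D ≤ (u + v) + (e + e) → (yb - - u) + (yb - v) ≤ D → 0ℚ ≤ xa →
      ya ≡ xa + v → yb ≡ xb - u → e < yb - ya → ⊥
    b-backward {e} {u} {v} {D} xa xb large bb xa≥0 refl refl a≺b =
      <⇒≢ (+-mono-<-≤ (+-mono-<-≤ (+-mono-<-≤ (+-mono-< a≺b a≺b) bb) (+-mono-≤ xa≥0 xa≥0)) large)
          (solve (e ∷ u ∷ v ∷ D ∷ xa ∷ xb ∷ []) ℚ-ring)
    both-forward : ∀ {e u v D} xa xb {ya yb} → D ≤ (u + v) + (e + e) → xb - xa ≤ D - e →
      ya ≡ xa + v → yb ≡ xb - u → e < yb - ya → ⊥
    both-forward {e} {u} {v} {D} xa xb large near refl refl a≺b =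
      <⇒≢ (+-mono-<-≤ (+-mono-<-≤ a≺b near) large) (solve (e ∷ u ∷ v ∷ D ∷ xa ∷ xb ∷ []) ℚ-ring)
    not-below : ¬ a ≺[ suc i ] b
    not-below (gap a≺b) with greedy a | greedy b
    ... | inj₂ Ba | _ =
      a-backward xa xb large (backward-up Ba a↑) (proj₂ (strip b (inject₁ i))) (step-up a↑) (step-down b↓) a≺b
    ... | inj₁ _ | inj₂ Bb =
      b-backward xa xb large (backward-down Bb b↓) (proj₁ (strip a (inject₁ i))) (step-up a↑) (step-down b↓) a≺b
    ... | inj₁ Fa | inj₁ Fb =
      both-forward xa xb large (proj₂ (forward-near Fa Fb a≢b (inject₁ i))) (step-up a↑) (step-down b↓) a≺b

  OrderKept⇒below≡ : a ≢ b → OrderKept a b i → below a b (suc i) ≡ below a b (inject₁ i)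
  OrderKept⇒below≡ {i = i} a≢b (keeps-≺ , keeps-≻) with ≺-total {k = inject₁ i} a≢b
  ... | inj₁ a≺b = trans (below-true (keeps-≺ a≺b)) (sym (below-true a≺b))
  ... | inj₂ b≺a = trans (below-false (keeps-≻ b≺a)) (sym (below-false b≺a))

  crosses : Fin 3 → Fin (suc m) → Bool
  crosses a i = [ const false , const true ]′ (small-or-large i) ∧ [ const true , const false ]′ (move a i)

  below-step : a ≢ b → ∀ i → below a b (suc i) ≡ (crosses a i xor crosses b i) xor below a b (inject₁ i)
  below-step {a} {b} a≢b i with small-or-large i | move a i | move b i
  ... | inj₁ small | _       | _       = OrderKept⇒below≡ a≢b (small-keeps-order small a≢b)
  ... | inj₂ _     | inj₁ a↑ | inj₁ b↑ = OrderKept⇒below≡ a≢b (same-move-kept (trans a↑ (sym b↑)))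
  ... | inj₂ _     | inj₂ a↓ | inj₂ b↓ = OrderKept⇒below≡ a≢b (same-move-kept (trans a↓ (sym b↓)))
  ... | inj₂ large | inj₁ a↑ | inj₂ b↓ =
    trans (below-false (large-up-down-after large a≢b a↑ b↓))
          (cong not (sym (below-true (large-up-down-before large a≢b a↑ b↓))))
  ... | inj₂ large | inj₂ a↓ | inj₁ b↑ =
    trans (below-true (large-up-down-after large (a≢b ∘ sym) b↑ a↓))
          (cong not (sym (below-false (large-up-down-before large (a≢b ∘ sym) b↑ a↓))))

  parity : Fin 3 → Fin 3 → Fin 3 → Time → Bool
  parity a b c k = below a b k xor (below b c k xor below a c k)

  parity-step : a ≢ b → b ≢ c → a ≢ c → ∀ i → parity a b c (suc i) ≡ parity a b c (inject₁ i)
  parity-step {a} {b} {c} a≢b b≢c a≢c i =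
    trans (cong₂ _xor_ (below-step a≢b i) (cong₂ _xor_ (below-step b≢c i) (below-step a≢c i)))
          (xor-flips-cancel (crosses a i) (crosses b i) (crosses c i) _ _ _)

  parity-invariant : a ≢ b → b ≢ c → a ≢ c → ∀ k → parity a b c k ≡ parity a b c zero
  parity-invariant {a} {b} {c} a≢b b≢c a≢c =
    <-weakInduction (λ k → parity a b c k ≡ parity a b c zero) refl
      (λ i ih → trans (parity-step a≢b b≢c a≢c i) ih)

  ordered⇒odd : a ≺[ k ] b → b ≺[ k ] c → parity a b c k ≡ true
  ordered⇒odd a≺b b≺c =
    cong₂ _xor_ (below-true a≺b) (cong₂ _xor_ (below-true b≺c) (below-true (≺-trans a≺b b≺c)))

  odd⇒cyclic : a ≢ b → b ≢ c → a ≢ c → parity a b c k ≡ true → CyclicallyOrdered _≺[ k ]_ a b c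
  odd⇒cyclic {a} {b} {c} {k} a≢b b≢c a≢c odd = classify (≺-total a≢b) (≺-total b≢c) (≺-total a≢c)
    where
    odd-for : ∀ {x y w} → below a b k ≡ x → below b c k ≡ y → below a c k ≡ w → x xor (y xor w) ≡ true
    odd-for ab bc ac = trans (sym (cong₂ _xor_ ab (cong₂ _xor_ bc ac))) odd

    classify : a ≺[ k ] b ⊎ b ≺[ k ] a → b ≺[ k ] c ⊎ c ≺[ k ] b → a ≺[ k ] c ⊎ c ≺[ k ] a →
      CyclicallyOrdered _≺[ k ]_ a b c
    classify (inj₁ a≺b) (inj₁ b≺c) _          = inj₁ (a≺b , b≺c)
    classify (inj₂ b≺a) (inj₁ b≺c) (inj₂ c≺a) = inj₂ (inj₁ (b≺c , c≺a))
    classify (inj₁ a≺b) (inj₂ c≺b) (inj₂ c≺a) = inj₂ (inj₂ (c≺a , a≺b))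
    classify (inj₂ b≺a) (inj₂ c≺b) (inj₁ a≺c) = ⊥-elim (≺-irrefl (≺-trans a≺c (≺-trans c≺b b≺a)))
    classify (inj₁ a≺b) (inj₂ c≺b) (inj₁ a≺c) =
      case odd-for (below-true a≺b) (below-false c≺b) (below-true a≺c) of λ ()
    classify (inj₂ b≺a) (inj₁ b≺c) (inj₁ a≺c) =
      case odd-for (below-false b≺a) (below-true b≺c) (below-true a≺c) of λ ()
    classify (inj₂ b≺a) (inj₂ c≺b) (inj₂ c≺a) =
      case odd-for (below-false b≺a) (below-false c≺b) (below-false c≺a) of λ ()

  sortings-cyclic : ∀ {a b c a′ b′ c′} → SortingBy p0 a b c → SortingBy (λ x → X x end) a′ b′ c′ →
    CyclicOf a b c a′ b′ c′
  sortings-cyclic {a} {b} {c} (a≢b , b≢c , a≢c , a≤b , b≤c) (a′≢b′ , b′≢c′ , _ , a′≤b′ , b′≤c′) =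
    cyclic⇒CyclicOf (odd⇒cyclic a≢b b≢c a≢c odd-at-end) (≤⇒≺ {k = end} a′≢b′ a′≤b′) (≤⇒≺ b′≢c′ b′≤c′)
    where
    open CyclicOrder _≺[ end ]_ ≺-irrefl ≺-trans
    odd-at-end : parity a b c end ≡ true
    odd-at-end = trans (parity-invariant a≢b b≢c a≢c end) (ordered⇒odd (≤⇒≺ {k = zero} a≢b a≤b) (≤⇒≺ b≢c b≤c))

lemma9 : (m : ℕ) (u v : Fin (suc m) → ℚ) (D δ : ℚ) →
    (∀ i → 0ℚ < u i) → (∀ i → 0ℚ < v i) →
    (∀ i → u i + v i ≤ D) → (∃[ i ] (u i + v i ≡ D)) →
    0ℚ < δ → δ < ½ →
    (∀ i → InInterval 0ℚ (δ * D) (u i + v i) ⊎ InInterval ((1ℚ - δ) * D) D (u i + v i)) →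
    (p0 : Fin 3 → ℚ) (z : Fin 3 → Fin (suc m) → ℚ) →
    (∀ a → Greedy u v D δ (p0 a) (z a)) →
    (∀ a → LivesOnStrip D (p0 a) (z a)) →
    (∃[ i ] ∃[ j ] ∃[ k ] ∃[ i′ ] ∃[ j′ ] ∃[ k′ ]
       (SortingBy p0 i j k ×
        SortingBy (λ a → pattern′ (p0 a) (z a) (fromℕ (suc m))) i′ j′ k′ ×
        ¬ CyclicOf i j k i′ j′ k′)) →
    ∃[ a ] ∃[ b ] ((a ≢ b) × Close (½ * δ * D) (p0 a) (z a) (p0 b) (z b))
lemma9 m u v D δ u>0 v>0 d≤D (i , dᵢ≡D) δ>0 _ sizes p0 z greedy strip
       (_ , _ , _ , _ , _ , _ , sorted-start , sorted-end , not-cyclic)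
  with close-pair? (½ * δ * D) p0 z
... | yes close-pair   = close-pair
... | no no-close-pair = ⊥-elim (not-cyclic (sortings-cyclic sorted-start sorted-end))
  where
  D>0 : 0ℚ < D
  D>0 = subst (0ℚ <_) dᵢ≡D (+-mono-< (u>0 i) (v>0 i))

  apart : ∀ a b → a ≢ b → ¬ Close (½ * δ * D) (p0 a) (z a) (p0 b) (z b)
  apart a b a≢b close = no-close-pair (a , b , a≢b , close)

  open SeparatedGreedyTriple m u v D δ u>0 v>0 d≤D (*-pos (*-pos (positive⁻¹ ½) δ>0) D>0)
    sizes p0 z greedy strip apart
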